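{- Let $n \equiv 0 \pmod 4$ be a positive integer. If $S_n^2(X_1,\dots,X_n)$ can be computed over $\mathrm{GF}(2)$ by a homogeneous $\Sigma\Pi\Sigma$ circuit using $\frac{n}{2}$ multiplication gates, then $S_{n+1}^2(X_1,\dots,X_{n+1})$ can be computed over $\mathrm{GF}(2)$ by a homogeneous $\Sigma\Pi\Sigma$ circuit using $\frac{n}{2}$ multiplication gates.
   Context: $S_n^2(X_1,\dots,X_n) = \sum_{1\le i<j\le n} X_iX_j$. A $\Sigma\Pi\Sigma$ circuit over a field $\mathbb{F}$ in variables $X_1,\dots,X_n$ is an expression $\sum_{i=1}^r \prod_{j=1}^{s_i} L_{ij}(X)$ where each $L_{ij}$ is a linear form $a_0+\sum_{k=1}^n a_kX_k$ with $a_0,\dots,a_n\in\mathbb{F}$; $r$ is its number of multiplication gates. It is homogeneous if every $L_{ij}$ has constant term $0$. It computes a polynomial $P$ if the expression equals $P$ in $\mathbb{F}[X_1,\dots,X_n]$. -}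

module Defs where

open import Data.Bool using (Bool; true; false; _∧_; _xor_; if_then_else_)
open import Data.Nat using (ℕ; zero; suc; _∸_)
open import Data.Fin using (Fin; _<?_)
open import Data.Vec using (Vec; []; _∷_; replicate; lookup)
open import Data.Vec.Properties using (≡-dec)
open import Data.List using (List; []; _∷_; foldr; map; concatMap; allFin; upTo; [_])
open import Data.Product using (_×_; _,_)
open import Relation.Nullary.Decidable using (⌊_⌋)
open import Relation.Binary.PropositionalEquality using (_≡_)
import Data.Nat.Properties as ℕP

-- GF(2) is modelled by Bool with _xor_ as addition and _∧_ as multiplication.

Mono : ℕ → Set
Mono n = Vec ℕ n

-- A polynomial over GF(2) in n variables, as its coefficient function
-- (the standard construction of F[X_1..X_n] as coefficient functions
-- with the Cauchy product; all polynomials built below have finite support).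
Poly : ℕ → Set
Poly n = Mono n → Bool

splits : ∀ {n} → Mono n → List (Mono n × Mono n)
splits [] = ([] , []) ∷ []
splits (x ∷ e) =
  concatMap (λ k → map (λ { (a , b) → (k ∷ a , (x ∸ k) ∷ b) }) (splits e))
            (upTo (suc x))

0ₚ : ∀ {n} → Poly n
0ₚ e = false

_+ₚ_ : ∀ {n} → Poly n → Poly n → Poly n
(P +ₚ Q) e = P e xor Q e

_*ₚ_ : ∀ {n} → Poly n → Poly n → Poly n
(P *ₚ Q) e = foldr _xor_ false (map (λ { (a , b) → P a ∧ Q b }) (splits e))

1ₚ : ∀ {n} → Poly n
1ₚ {n} e = ⌊ ≡-dec ℕP._≟_ e (replicate n 0) ⌋

sumₚ : ∀ {n} → List (Poly n) → Poly n
sumₚ = foldr _+ₚ_ 0ₚ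

prodₚ : ∀ {n} → List (Poly n) → Poly n
prodₚ = foldr _*ₚ_ 1ₚ

unitMono : ∀ {n} → Fin n → Mono n
unitMono {suc n} Fin.zero = 1 ∷ replicate n 0
unitMono {suc n} (Fin.suc i) = 0 ∷ unitMono i

X : ∀ {n} → Fin n → Poly n
X i e = ⌊ ≡-dec ℕP._≟_ e (unitMono i) ⌋

scale : ∀ {n} → Bool → Poly n → Poly n
scale c P e = c ∧ P e

S2 : (n : ℕ) → Poly n
S2 n = sumₚ (concatMap (λ i → concatMap (λ j →
          if ⌊ i <? j ⌋ then [ X i *ₚ X j ] else []) (allFin n)) (allFin n))

-- A homogeneous linear form over GF(2) in n variables: Σ_k a_k X_k
-- (constant term 0), given by its coefficient vector (a_1..a_n).
HomLinForm : ℕ → Set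
HomLinForm n = Vec Bool n

linPoly : ∀ {n} → HomLinForm n → Poly n
linPoly {n} a = sumₚ (map (λ k → scale (lookup a k) (X k)) (allFin n))

-- A homogeneous ΣΠΣ circuit over GF(2) in n variables with exactly r
-- multiplication gates; gate i is the list of its linear factors L_i1..L_is_i.
HomΣΠΣ : ℕ → ℕ → Set
HomΣΠΣ n r = Vec (List (HomLinForm n)) r

evalCircuit : ∀ {n r} → HomΣΠΣ n r → Poly n
evalCircuit [] = 0ₚ
evalCircuit (g ∷ gs) = prodₚ (map linPoly g) +ₚ evalCircuit gs

Computes : ∀ {n r} → HomΣΠΣ n r → Poly n → Set
Computes C P = ∀ e → evalCircuit C e ≡ P e

module Submission where

-- Replace every variable Xᵢ by Xᵢ₊₁ + X₀ in each linear form of the circuit. This keeps the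
-- circuit homogeneous with the same gates, and turns S_n^2 into
--   S_n^2(X₁, …, Xₙ) + (n - 1) X₀ Σᵢ Xᵢ + C(n, 2) X₀²,
-- which over GF(2) is S_{n+1}^2 as soon as n and C(n, 2) are even, i.e. when 4 ∣ n.
-- Since polynomials are coefficient functions, the substitution Φ is defined on coefficients,
-- through binomial coefficients mod 2, one variable at a time; that it is multiplicative is the
-- Leibniz rule for Hasse derivatives, which reduces to Vandermonde's identity.

open import Defs
open import Algebra.Bundles using (CommutativeMonoid; CommutativeRing)
open import Data.Bool using (Bool; true; false; not; _∧_; _xor_; if_then_else_)
open import Data.Bool.Properties
  using (∧-comm; ∧-assoc; not-involutive; xor-same; ∧-zeroʳ; xor-assoc; xor-comm; xor-identityʳ;
         ∧-distribˡ-xor; ∧-distribʳ-xor; ∧-commutativeMonoid; xor-∧-commutativeRing)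
open import Data.Empty using (⊥-elim)
open import Data.List using (List; []; _∷_; [_]; foldr; map; concatMap; _++_; upTo; applyUpTo; tabulate; allFin)
open import Data.Product using (_×_; _,_; proj₁; proj₂; ∃)
open import Data.Nat.DivMod using (_/_)
open import Data.Nat.Divisibility using (_∣_; divides)
open import Data.Nat using (ℕ; zero; suc; _+_; _*_; _∸_; _≤_; _<_; z≤n; s≤s; _≡ᵇ_; _≤?_)
open import Data.Nat.Properties
  using (_≟_; +-commutativeSemigroup; +-suc; +-identityʳ; m+[n∸m]≡n; m∸[m∸n]≡n; m+n∸m≡n; m≤m+n;
         +-∸-assoc; n∸n≡0; ≤-refl; ≰⇒>; m<n⇒m<1+n; +-cancelˡ-≡; +-cancelʳ-≡)
open import Data.Vec as Vec using ([]; _∷_; lookup)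
open import Data.Fin using (Fin; _<?_) renaming (zero to fzero; suc to fsuc)
open import Relation.Nullary using (Dec; yes; no; does)
open import Relation.Nullary.Decidable using (⌊_⌋; isYes≗does)
open import Relation.Binary.PropositionalEquality hiding ([_])

open import Algebra.Properties.CommutativeSemigroup
  (CommutativeMonoid.commutativeSemigroup (CommutativeRing.+-commutativeMonoid xor-∧-commutativeRing))
  using () renaming (interchange to xor-interchange; x∙yz≈y∙xz to xor-swapˡ)
open import Algebra.Properties.CommutativeSemigroup +-commutativeSemigroup
  using () renaming (interchange to +-interchange)
open import Algebra.Properties.CommutativeSemigroup
  (CommutativeMonoid.commutativeSemigroup ∧-commutativeMonoid)
  using () renaming (x∙yz≈y∙xz to ∧-swapˡ)

sumUpTo : ℕ → (ℕ → Bool) → Bool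
sumUpTo zero    f = f 0
sumUpTo (suc x) f = f 0 xor sumUpTo x (λ k → f (suc k))

sumUpTo-cong : ∀ x {f g : ℕ → Bool} → (∀ k → k ≤ x → f k ≡ g k) → sumUpTo x f ≡ sumUpTo x g
sumUpTo-cong zero    f≗g = f≗g 0 z≤n
sumUpTo-cong (suc x) f≗g =
  cong₂ _xor_ (f≗g 0 z≤n) (sumUpTo-cong x (λ k k≤x → f≗g (suc k) (s≤s k≤x)))

sumUpTo-zero : ∀ x {f : ℕ → Bool} → (∀ k → k ≤ x → f k ≡ false) → sumUpTo x f ≡ false
sumUpTo-zero zero    f≡0 = f≡0 0 z≤n
sumUpTo-zero (suc x) f≡0 =
  cong₂ _xor_ (f≡0 0 z≤n) (sumUpTo-zero x (λ k k≤x → f≡0 (suc k) (s≤s k≤x)))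

sumUpTo-xor : ∀ x (f g : ℕ → Bool) →
  sumUpTo x (λ k → f k xor g k) ≡ sumUpTo x f xor sumUpTo x g
sumUpTo-xor zero    f g = refl
sumUpTo-xor (suc x) f g =
  trans (cong ((f 0 xor g 0) xor_) (sumUpTo-xor x _ _)) (xor-interchange (f 0) (g 0) _ _)

∧-distribˡ-sumUpTo : ∀ x c (f : ℕ → Bool) → c ∧ sumUpTo x f ≡ sumUpTo x (λ k → c ∧ f k)
∧-distribˡ-sumUpTo zero    c f = refl
∧-distribˡ-sumUpTo (suc x) c f =
  trans (∧-distribˡ-xor c (f 0) _) (cong ((c ∧ f 0) xor_) (∧-distribˡ-sumUpTo x c _))

∧-distribʳ-sumUpTo : ∀ x c (f : ℕ → Bool) → sumUpTo x f ∧ c ≡ sumUpTo x (λ k → f k ∧ c)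
∧-distribʳ-sumUpTo x c f =
  trans (∧-comm _ c)
        (trans (∧-distribˡ-sumUpTo x c f) (sumUpTo-cong x (λ k _ → ∧-comm c (f k))))

sumUpTo-head : ∀ x (f : ℕ → Bool) → (∀ k → f (suc k) ≡ false) → sumUpTo x f ≡ f 0
sumUpTo-head zero    f f[1+k]≡0 = refl
sumUpTo-head (suc x) f f[1+k]≡0 =
  trans (cong (f 0 xor_) (sumUpTo-zero x (λ k _ → f[1+k]≡0 k))) (xor-identityʳ (f 0))

sumUpTo-last : ∀ x (f : ℕ → Bool) → sumUpTo (suc x) f ≡ sumUpTo x f xor f (suc x)
sumUpTo-last zero    f = refl
sumUpTo-last (suc x) f =
  trans (cong (f 0 xor_) (sumUpTo-last x (λ k → f (suc k)))) (sym (xor-assoc (f 0) _ _))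

sumUpTo-comm : ∀ x y (F : ℕ → ℕ → Bool) →
  sumUpTo x (λ i → sumUpTo y (F i)) ≡ sumUpTo y (λ j → sumUpTo x (λ i → F i j))
sumUpTo-comm zero    y F = refl
sumUpTo-comm (suc x) y F =
  trans (cong (sumUpTo y (F 0) xor_) (sumUpTo-comm x y (λ i → F (suc i))))
        (sym (sumUpTo-xor y (F 0) _))

sumUpTo-reverse : ∀ x (f : ℕ → Bool) → sumUpTo x f ≡ sumUpTo x (λ k → f (x ∸ k))
sumUpTo-reverse zero    f = refl
sumUpTo-reverse (suc x) f = begin
    f 0 xor sumUpTo x (λ k → f (suc k))
  ≡⟨ cong (f 0 xor_) (sumUpTo-reverse x (λ k → f (suc k))) ⟩
    f 0 xor sumUpTo x (λ k → f (suc (x ∸ k)))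
  ≡⟨ xor-comm (f 0) _ ⟩
    sumUpTo x (λ k → f (suc (x ∸ k))) xor f 0
  ≡⟨ cong₂ _xor_ (sumUpTo-cong x (λ k k≤x → cong f (sym (+-∸-assoc 1 k≤x))))
                 (cong f (sym (n∸n≡0 x))) ⟩
    sumUpTo x (λ k → f (suc x ∸ k)) xor f (suc x ∸ suc x)
  ≡⟨ sym (sumUpTo-last x (λ k → f (suc x ∸ k))) ⟩
    sumUpTo (suc x) (λ k → f (suc x ∸ k)) ∎
  where open ≡-Reasoning

sumUpTo-indicator : ∀ x J (f : ℕ → Bool) → J ≤ x → sumUpTo x (λ j → (j ≡ᵇ J) ∧ f j) ≡ f J
sumUpTo-indicator zero    zero    f z≤n = refl
sumUpTo-indicator (suc x) zero    f z≤n =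
  trans (cong (f 0 xor_) (sumUpTo-zero x (λ k _ → refl))) (xor-identityʳ (f 0))
sumUpTo-indicator (suc x) (suc J) f (s≤s J≤x) = sumUpTo-indicator x J (λ j → f (suc j)) J≤x

sumUpTo-indicator-out : ∀ x J (f : ℕ → Bool) → x < J → sumUpTo x (λ j → (j ≡ᵇ J) ∧ f j) ≡ false
sumUpTo-indicator-out zero    (suc J) f _ = refl
sumUpTo-indicator-out (suc x) (suc J) f (s≤s x<J) = sumUpTo-indicator-out x J (λ j → f (suc j)) x<J

convolve : ℕ → (ℕ → ℕ → Bool) → Bool
convolve x F = sumUpTo x (λ k → F k (x ∸ k))

convolve-cong : ∀ x {F G : ℕ → ℕ → Bool} → (∀ a b → a + b ≡ x → F a b ≡ G a b) →
  convolve x F ≡ convolve x G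
convolve-cong x F≗G = sumUpTo-cong x (λ k k≤x → F≗G k (x ∸ k) (m+[n∸m]≡n k≤x))

convolve-comm : ∀ x (F : ℕ → ℕ → Bool) → convolve x F ≡ convolve x (λ a b → F b a)
convolve-comm x F =
  trans (sumUpTo-reverse x _) (sumUpTo-cong x (λ k k≤x → cong (F (x ∸ k)) (m∸[m∸n]≡n k≤x)))

convolve-assoc : ∀ x (G : ℕ → ℕ → ℕ → Bool) →
  convolve x (λ m c → convolve m (λ a b → G a b c)) ≡
  convolve x (λ a m → convolve m (λ b c → G a b c))
convolve-assoc zero    G = refl
convolve-assoc (suc x) G = begin
    G 0 0 (suc x) xor convolve x (λ m c → convolve (suc m) (λ a b → G a b c))
  ≡⟨ cong (G 0 0 (suc x) xor_) (sumUpTo-xor x _ _) ⟩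
    G 0 0 (suc x) xor (convolve x (λ m c → G 0 (suc m) c) xor
                       convolve x (λ m c → convolve m (λ a b → G (suc a) b c)))
  ≡⟨ sym (xor-assoc (G 0 0 (suc x)) _ _) ⟩
    convolve (suc x) (G 0) xor convolve x (λ m c → convolve m (λ a b → G (suc a) b c))
  ≡⟨ cong (convolve (suc x) (G 0) xor_) (convolve-assoc x (λ a → G (suc a))) ⟩
    convolve (suc x) (G 0) xor convolve x (λ a m → convolve m (G (suc a))) ∎
  where open ≡-Reasoning

convolve-interchange : ∀ x (G : ℕ → ℕ → ℕ → ℕ → Bool) →
  convolve x (λ p q → convolve p (λ k j₁ → convolve q (λ c j₂ → G k j₁ c j₂))) ≡
  convolve x (λ s J → convolve s (λ k c → convolve J (λ j₁ j₂ → G k j₁ c j₂)))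
convolve-interchange x G = begin
    convolve x (λ p q → convolve p (λ k j₁ → convolve q (λ c j₂ → G k j₁ c j₂)))
  ≡⟨ convolve-assoc x (λ k j₁ q → convolve q (λ c j₂ → G k j₁ c j₂)) ⟩
    convolve x (λ k m → convolve m (λ j₁ q → convolve q (λ c j₂ → G k j₁ c j₂)))
  ≡⟨ convolve-cong x (λ k m _ → sym (convolve-assoc m (λ j₁ c j₂ → G k j₁ c j₂))) ⟩
    convolve x (λ k m → convolve m (λ r j₂ → convolve r (λ j₁ c → G k j₁ c j₂)))
  ≡⟨ convolve-cong x (λ k m _ → convolve-cong m (λ r j₂ _ → convolve-comm r (λ j₁ c → G k j₁ c j₂))) ⟩
    convolve x (λ k m → convolve m (λ r j₂ → convolve r (λ c j₁ → G k j₁ c j₂)))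
  ≡⟨ convolve-cong x (λ k m _ → convolve-assoc m (λ c j₁ j₂ → G k j₁ c j₂)) ⟩
    convolve x (λ k m → convolve m (λ c J → convolve J (λ j₁ j₂ → G k j₁ c j₂)))
  ≡⟨ sym (convolve-assoc x (λ k c J → convolve J (λ j₁ j₂ → G k j₁ c j₂))) ⟩
    convolve x (λ s J → convolve s (λ k c → convolve J (λ j₁ j₂ → G k j₁ c j₂))) ∎
  where open ≡-Reasoning

convolve-indicator : ∀ x J (F : ℕ → ℕ → Bool) →
  convolve (x + J) (λ a b → (a ≡ᵇ x) ∧ F a b) ≡ F x J
convolve-indicator x J F =
  trans (sumUpTo-indicator (x + J) x (λ k → F k (x + J ∸ k)) (m≤m+n x J))
        (cong (F x) (m+n∸m≡n x J))

binom : ℕ → ℕ → Bool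
binom n       zero    = true
binom zero    (suc k) = false
binom (suc n) (suc k) = binom n k xor binom n (suc k)

binom-vanishes : ∀ n k → n < k → binom n k ≡ false
binom-vanishes zero    (suc k) _ = refl
binom-vanishes (suc n) (suc k) (s≤s n<k) =
  cong₂ _xor_ (binom-vanishes n k n<k) (binom-vanishes n (suc k) (m<n⇒m<1+n n<k))

vandermonde : ∀ p q J →
  sumUpTo p (λ i → binom p i ∧ sumUpTo q (λ j → ((i + j) ≡ᵇ J) ∧ binom q j)) ≡ binom (p + q) J
vandermonde zero q J with J ≤? q
... | yes J≤q = sumUpTo-indicator q J (binom q) J≤q
... | no  J≰q = trans (sumUpTo-indicator-out q J (binom q) (≰⇒> J≰q))
                      (sym (binom-vanishes q J (≰⇒> J≰q)))
vandermonde (suc p) q zero =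
  cong₂ _xor_ (sumUpTo-indicator q 0 (binom q) z≤n)
              (sumUpTo-zero p (λ i _ → trans (cong (binom (suc p) (suc i) ∧_)
                                                   (sumUpTo-zero q (λ _ _ → refl)))
                                             (∧-zeroʳ _)))
vandermonde (suc p) q (suc J) = begin
    inner (suc J) 0 xor sumUpTo p (λ i → (binom p i xor binom p (suc i)) ∧ inner J i)
  ≡⟨ cong (inner (suc J) 0 xor_)
          (trans (sumUpTo-cong p (λ i _ → ∧-distribʳ-xor (inner J i) (binom p i) _))
                 (sumUpTo-xor p _ _)) ⟩
    inner (suc J) 0 xor (outer J xor sumUpTo p (λ i → binom p (suc i) ∧ inner (suc J) (suc i)))
  ≡⟨ xor-swapˡ (inner (suc J) 0) (outer J) _ ⟩
    outer J xor (inner (suc J) 0 xor sumUpTo p (λ i → binom p (suc i) ∧ inner (suc J) (suc i)))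
  ≡⟨ cong (outer J xor_) (trans (sumUpTo-last p (λ i → binom p i ∧ inner (suc J) i))
          (trans (cong (λ b → outer (suc J) xor (b ∧ inner (suc J) (suc p)))
                       (binom-vanishes p (suc p) ≤-refl))
                 (xor-identityʳ _))) ⟩
    outer J xor outer (suc J)
  ≡⟨ cong₂ _xor_ (vandermonde p q J) (vandermonde p q (suc J)) ⟩
    binom (p + q) J xor binom (p + q) (suc J) ∎
  where
  open ≡-Reasoning
  inner : ℕ → ℕ → Bool
  inner J i = sumUpTo q (λ j → ((i + j) ≡ᵇ J) ∧ binom q j)
  outer : ℕ → Bool
  outer J = sumUpTo p (λ i → binom p i ∧ inner J i)

≡ᵇ-cancel : ∀ a b x y → a + b ≡ x + y → (a ≡ᵇ x) ≡ (b ≡ᵇ y)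
≡ᵇ-cancel a b x y a+b≡x+y = decide (a ≟ x) (b ≟ y)
  where
  decide : (a≟x : Dec (a ≡ x)) (b≟y : Dec (b ≡ y)) → does a≟x ≡ does b≟y
  decide (yes _)   (yes _)   = refl
  decide (no _)    (no _)    = refl
  decide (yes a≡x) (no b≢y)  =
    ⊥-elim (b≢y (+-cancelˡ-≡ x b y (trans (cong (_+ b) (sym a≡x)) a+b≡x+y)))
  decide (no a≢x)  (yes b≡y) =
    ⊥-elim (a≢x (+-cancelʳ-≡ b a x (trans a+b≡x+y (cong (x +_) (sym b≡y)))))

-- The Leibniz rule D⁽ᴶ⁾(PQ) = Σ_{j₁+j₂=J} D⁽ʲ¹⁾P · D⁽ʲ²⁾Q for the Hasse derivatives
-- D⁽ʲ⁾Xᵐ = C(m,j) Xᵐ⁻ʲ, read off on the coefficient of Xˣ (with V p q = P_p Q_q).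
hasse-leibniz : ∀ x J (V : ℕ → ℕ → Bool) →
  binom (x + J) J ∧ convolve (x + J) V ≡
  convolve x (λ k c → convolve J (λ j₁ j₂ →
    binom (k + j₁) j₁ ∧ (binom (c + j₂) j₂ ∧ V (k + j₁) (c + j₂))))
hasse-leibniz x J V = begin
    binom (x + J) J ∧ convolve (x + J) V
  ≡⟨ ∧-distribˡ-sumUpTo (x + J) (binom (x + J) J) (λ p → V p (x + J ∸ p)) ⟩
    convolve (x + J) (λ p q → binom (x + J) J ∧ V p q)
  ≡⟨ convolve-cong (x + J) (λ p q p+q≡x+J → sym (split p q p+q≡x+J)) ⟩
    convolve (x + J) (λ p q → convolve p (λ k j₁ → convolve q (λ c j₂ → ((k + c) ≡ᵇ x) ∧ D k c j₁ j₂)))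
  ≡⟨ convolve-interchange (x + J) (λ k j₁ c j₂ → ((k + c) ≡ᵇ x) ∧ D k c j₁ j₂) ⟩
    convolve (x + J) (λ s J′ → convolve s (λ k c → convolve J′ (λ j₁ j₂ → ((k + c) ≡ᵇ x) ∧ D k c j₁ j₂)))
  ≡⟨ convolve-cong (x + J) (λ s J′ _ → pull s J′) ⟩
    convolve (x + J) (λ s J′ → (s ≡ᵇ x) ∧ convolve s (λ k c → convolve J′ (D k c)))
  ≡⟨ convolve-indicator x J (λ s J′ → convolve s (λ k c → convolve J′ (D k c))) ⟩
    convolve x (λ k c → convolve J (D k c)) ∎
  where
  open ≡-Reasoning
  D : ℕ → ℕ → ℕ → ℕ → Bool
  D k c j₁ j₂ = binom (k + j₁) j₁ ∧ (binom (c + j₂) j₂ ∧ V (k + j₁) (c + j₂))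
  pull : ∀ s J′ →
    convolve s (λ k c → convolve J′ (λ j₁ j₂ → ((k + c) ≡ᵇ x) ∧ D k c j₁ j₂)) ≡
    (s ≡ᵇ x) ∧ convolve s (λ k c → convolve J′ (D k c))
  pull s J′ = trans
    (convolve-cong s (λ k c k+c≡s →
      trans (sym (∧-distribˡ-sumUpTo J′ ((k + c) ≡ᵇ x) (λ j₁ → D k c j₁ (J′ ∸ j₁))))
            (cong (λ t → (t ≡ᵇ x) ∧ convolve J′ (D k c)) k+c≡s)))
    (sym (∧-distribˡ-sumUpTo s (s ≡ᵇ x) (λ k → convolve J′ (D k (s ∸ k)))))
  rearrange : ∀ e b c v → e ∧ (b ∧ (c ∧ v)) ≡ (b ∧ (e ∧ c)) ∧ v
  rearrange false b c v = sym (cong (_∧ v) (∧-zeroʳ b))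
  rearrange true  b c v = sym (∧-assoc b c v)
  factor : ∀ p q j₁ → sumUpTo q (λ j₂ → ((j₁ + j₂) ≡ᵇ J) ∧ (binom p j₁ ∧ (binom q j₂ ∧ V p q))) ≡
    (binom p j₁ ∧ sumUpTo q (λ j₂ → ((j₁ + j₂) ≡ᵇ J) ∧ binom q j₂)) ∧ V p q
  factor p q j₁ =
    trans (sumUpTo-cong q (λ j₂ _ → rearrange ((j₁ + j₂) ≡ᵇ J) (binom p j₁) (binom q j₂) (V p q)))
    (trans (sym (∧-distribʳ-sumUpTo q (V p q) (λ j₂ → binom p j₁ ∧ (((j₁ + j₂) ≡ᵇ J) ∧ binom q j₂))))
           (cong (_∧ V p q) (sym (∧-distribˡ-sumUpTo q (binom p j₁) (λ j₂ → ((j₁ + j₂) ≡ᵇ J) ∧ binom q j₂)))))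
  split : ∀ p q → p + q ≡ x + J →
    convolve p (λ k j₁ → convolve q (λ c j₂ → ((k + c) ≡ᵇ x) ∧ D k c j₁ j₂)) ≡
    binom (x + J) J ∧ V p q
  split p q p+q≡x+J = begin
      convolve p (λ k j₁ → convolve q (λ c j₂ → ((k + c) ≡ᵇ x) ∧ D k c j₁ j₂))
    ≡⟨ convolve-cong p (λ k j₁ k+j₁≡p → convolve-cong q (λ c j₂ c+j₂≡q →
         trans (cong₂ (λ u w → ((k + c) ≡ᵇ x) ∧ (binom u j₁ ∧ (binom w j₂ ∧ V u w))) k+j₁≡p c+j₂≡q)
               (cong (λ t → t ∧ (binom p j₁ ∧ (binom q j₂ ∧ V p q)))
                     (same-indicator k c j₁ j₂ k+j₁≡p c+j₂≡q)))) ⟩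
      convolve p (λ _ j₁ → convolve q (λ _ j₂ → ((j₁ + j₂) ≡ᵇ J) ∧ (binom p j₁ ∧ (binom q j₂ ∧ V p q))))
    ≡⟨ convolve-comm p (λ _ j₁ → convolve q (λ _ j₂ → term j₁ j₂)) ⟩
      sumUpTo p (λ j₁ → convolve q (λ _ j₂ → ((j₁ + j₂) ≡ᵇ J) ∧ (binom p j₁ ∧ (binom q j₂ ∧ V p q))))
    ≡⟨ sumUpTo-cong p (λ j₁ _ → trans (convolve-comm q (λ _ j₂ → term j₁ j₂)) (factor p q j₁)) ⟩
      sumUpTo p (λ j₁ → (binom p j₁ ∧ sumUpTo q (λ j₂ → ((j₁ + j₂) ≡ᵇ J) ∧ binom q j₂)) ∧ V p q)
    ≡⟨ sym (∧-distribʳ-sumUpTo p (V p q) (λ j₁ → binom p j₁ ∧ sumUpTo q (λ j₂ → ((j₁ + j₂) ≡ᵇ J) ∧ binom q j₂))) ⟩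
      sumUpTo p (λ j₁ → binom p j₁ ∧ sumUpTo q (λ j₂ → ((j₁ + j₂) ≡ᵇ J) ∧ binom q j₂)) ∧ V p q
    ≡⟨ cong (_∧ V p q) (trans (vandermonde p q J) (cong (λ t → binom t J) p+q≡x+J)) ⟩
      binom (x + J) J ∧ V p q ∎
    where
    term : ℕ → ℕ → Bool
    term j₁ j₂ = ((j₁ + j₂) ≡ᵇ J) ∧ (binom p j₁ ∧ (binom q j₂ ∧ V p q))
    same-indicator : ∀ k c j₁ j₂ → k + j₁ ≡ p → c + j₂ ≡ q → ((k + c) ≡ᵇ x) ≡ ((j₁ + j₂) ≡ᵇ J)
    same-indicator k c j₁ j₂ k+j₁≡p c+j₂≡q = ≡ᵇ-cancel (k + c) (j₁ + j₂) x J
      (trans (+-interchange k c j₁ j₂) (trans (cong₂ _+_ k+j₁≡p c+j₂≡q) p+q≡x+J))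

sumList : {A : Set} → List A → (A → Bool) → Bool
sumList xs f = foldr _xor_ false (map f xs)

sumList-cong : {A : Set} (xs : List A) {f g : A → Bool} → f ≗ g → sumList xs f ≡ sumList xs g
sumList-cong []       f≗g = refl
sumList-cong (x ∷ xs) f≗g = cong₂ _xor_ (f≗g x) (sumList-cong xs f≗g)

sumList-map : {A B : Set} (h : A → B) (xs : List A) (f : B → Bool) →
  sumList (map h xs) f ≡ sumList xs (λ a → f (h a))
sumList-map h []       f = refl
sumList-map h (x ∷ xs) f = cong (f (h x) xor_) (sumList-map h xs f)

sumList-++ : {A : Set} (xs ys : List A) (f : A → Bool) →
  sumList (xs ++ ys) f ≡ sumList xs f xor sumList ys f
sumList-++ []       ys f = refl
sumList-++ (x ∷ xs) ys f = trans (cong (f x xor_) (sumList-++ xs ys f)) (sym (xor-assoc (f x) _ _))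

sumList-concatMap : {A B : Set} (h : A → List B) (xs : List A) (f : B → Bool) →
  sumList (concatMap h xs) f ≡ sumList xs (λ a → sumList (h a) f)
sumList-concatMap h []       f = refl
sumList-concatMap h (x ∷ xs) f =
  trans (sumList-++ (h x) (concatMap h xs) f) (cong (sumList (h x) f xor_) (sumList-concatMap h xs f))

sumList-applyUpTo : ∀ x (g : ℕ → ℕ) (f : ℕ → Bool) →
  sumList (applyUpTo g (suc x)) f ≡ sumUpTo x (λ k → f (g k))
sumList-applyUpTo zero    g f = xor-identityʳ (f (g 0))
sumList-applyUpTo (suc x) g f = cong (f (g 0) xor_) (sumList-applyUpTo x (λ k → g (suc k)) f)

sumList-sumUpTo : {A : Set} (xs : List A) (x : ℕ) (G : A → ℕ → Bool) →
  sumList xs (λ a → sumUpTo x (G a)) ≡ sumUpTo x (λ k → sumList xs (λ a → G a k))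
sumList-sumUpTo []       x G = sym (sumUpTo-zero x (λ _ _ → refl))
sumList-sumUpTo (a ∷ xs) x G =
  trans (cong (sumUpTo x (G a) xor_) (sumList-sumUpTo xs x G)) (sym (sumUpTo-xor x _ _))

sumList-xor : {A : Set} (xs : List A) (f g : A → Bool) →
  sumList xs (λ a → f a xor g a) ≡ sumList xs f xor sumList xs g
sumList-xor []       f g = refl
sumList-xor (a ∷ xs) f g =
  trans (cong ((f a xor g a) xor_) (sumList-xor xs f g)) (xor-interchange (f a) (g a) _ _)

∧-distribˡ-sumList : {A : Set} (xs : List A) (c : Bool) (f : A → Bool) →
  c ∧ sumList xs f ≡ sumList xs (λ a → c ∧ f a)
∧-distribˡ-sumList []       c f = ∧-zeroʳ c
∧-distribˡ-sumList (a ∷ xs) c f =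
  trans (∧-distribˡ-xor c (f a) _) (cong ((c ∧ f a) xor_) (∧-distribˡ-sumList xs c f))

slice : ∀ {n} → Poly (suc n) → ℕ → Poly n
slice P k e = P (k ∷ e)

*ₚ-slice : ∀ {n} (P Q : Poly (suc n)) x e →
  (P *ₚ Q) (x ∷ e) ≡ convolve x (λ k l → (slice P k *ₚ slice Q l) e)
*ₚ-slice {n} P Q x e =
  trans (sumList-concatMap pairsAt (upTo (suc x)) PQ)
  (trans (sumList-applyUpTo x (λ k → k) (λ k → sumList (pairsAt k) PQ))
         (sumUpTo-cong x (λ k _ → sumList-map (λ ab → k ∷ proj₁ ab , (x ∸ k) ∷ proj₂ ab) (splits e) PQ)))
  where
  pairsAt : ℕ → List (Mono (suc n) × Mono (suc n))
  pairsAt k = map (λ ab → k ∷ proj₁ ab , (x ∸ k) ∷ proj₂ ab) (splits e)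
  PQ : Mono (suc n) × Mono (suc n) → Bool
  PQ ab = P (proj₁ ab) ∧ Q (proj₂ ab)

*ₚ-cong : ∀ {n} {P P′ Q Q′ : Poly n} → P ≗ P′ → Q ≗ Q′ → P *ₚ Q ≗ P′ *ₚ Q′
*ₚ-cong P≗P′ Q≗Q′ e = sumList-cong (splits e) (λ ab → cong₂ _∧_ (P≗P′ (proj₁ ab)) (Q≗Q′ (proj₂ ab)))

*ₚ-comm : ∀ {n} (P Q : Poly n) → P *ₚ Q ≗ Q *ₚ P
*ₚ-comm P Q []      = cong (_xor false) (∧-comm (P []) (Q []))
*ₚ-comm P Q (x ∷ e) =
  trans (*ₚ-slice P Q x e)
  (trans (convolve-cong x (λ k l _ → *ₚ-comm (slice P k) (slice Q l) e))
  (trans (convolve-comm x (λ k l → (slice Q l *ₚ slice P k) e))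
         (sym (*ₚ-slice Q P x e))))

*ₚ-distribʳ-+ₚ : ∀ {n} (P P′ Q : Poly n) → (P +ₚ P′) *ₚ Q ≗ (P *ₚ Q) +ₚ (P′ *ₚ Q)
*ₚ-distribʳ-+ₚ P P′ Q e =
  trans (sumList-cong (splits e) (λ ab → ∧-distribʳ-xor (Q (proj₂ ab)) (P (proj₁ ab)) (P′ (proj₁ ab))))
        (sumList-xor (splits e) _ _)

*ₚ-distribˡ-+ₚ : ∀ {n} (P Q Q′ : Poly n) → P *ₚ (Q +ₚ Q′) ≗ (P *ₚ Q) +ₚ (P *ₚ Q′)
*ₚ-distribˡ-+ₚ P Q Q′ e =
  trans (sumList-cong (splits e) (λ ab → ∧-distribˡ-xor (P (proj₁ ab)) (Q (proj₂ ab)) (Q′ (proj₂ ab))))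
        (sumList-xor (splits e) _ _)

*ₚ-scaleˡ : ∀ {n} c (P Q : Poly n) → scale c P *ₚ Q ≗ scale c (P *ₚ Q)
*ₚ-scaleˡ c P Q e =
  trans (sumList-cong (splits e) (λ ab → ∧-assoc c (P (proj₁ ab)) (Q (proj₂ ab))))
        (sym (∧-distribˡ-sumList (splits e) c (λ ab → P (proj₁ ab) ∧ Q (proj₂ ab))))

*ₚ-scaleʳ : ∀ {n} c (P Q : Poly n) → P *ₚ scale c Q ≗ scale c (P *ₚ Q)
*ₚ-scaleʳ c P Q e =
  trans (sumList-cong (splits e) (λ ab → ∧-swapˡ (P (proj₁ ab)) c (Q (proj₂ ab))))
        (sym (∧-distribˡ-sumList (splits e) c (λ ab → P (proj₁ ab) ∧ Q (proj₂ ab))))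

*ₚ-sumUpToˡ : ∀ {n} x (F : ℕ → Poly n) (Q : Poly n) e →
  ((λ a → sumUpTo x (λ k → F k a)) *ₚ Q) e ≡ sumUpTo x (λ k → (F k *ₚ Q) e)
*ₚ-sumUpToˡ x F Q e =
  trans (sumList-cong (splits e) (λ ab → ∧-distribʳ-sumUpTo x (Q (proj₂ ab)) (λ k → F k (proj₁ ab))))
        (sumList-sumUpTo (splits e) x (λ ab k → F k (proj₁ ab) ∧ Q (proj₂ ab)))

*ₚ-sumUpToʳ : ∀ {n} x (P : Poly n) (F : ℕ → Poly n) e →
  (P *ₚ (λ a → sumUpTo x (λ k → F k a))) e ≡ sumUpTo x (λ k → (P *ₚ F k) e)
*ₚ-sumUpToʳ x P F e =
  trans (sumList-cong (splits e) (λ ab → ∧-distribˡ-sumUpTo x (P (proj₁ ab)) (λ k → F k (proj₂ ab))))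
        (sumList-sumUpTo (splits e) x (λ ab k → P (proj₁ ab) ∧ F k (proj₂ ab)))

-- shear Q = Q(X₀ + X₁, X₀, X₂, …)
shear : ∀ {n} → Poly (suc (suc n)) → Poly (suc (suc n))
shear Q (d ∷ x ∷ e) = convolve d (λ j b → binom (x + j) j ∧ Q ((x + j) ∷ b ∷ e))

onSlices : ∀ {n} → (Poly n → Poly (suc n)) → Poly (suc n) → Poly (suc (suc n))
onSlices f P (x ∷ e) = f (slice P x) e

-- Φ n P = P(X₁ + X₀, …, Xₙ + X₀), where X₀ is a new variable in front.
Φ : ∀ n → Poly n → Poly (suc n)
Φ zero    P (d ∷ e) = (d ≡ᵇ 0) ∧ P e
Φ (suc n) P         = shear (onSlices (Φ n) P)

Φ-cong : ∀ n {P P′ : Poly n} → P ≗ P′ → Φ n P ≗ Φ n P′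
Φ-cong zero    P≗P′ (d ∷ e)     = cong ((d ≡ᵇ 0) ∧_) (P≗P′ e)
Φ-cong (suc n) P≗P′ (d ∷ x ∷ e) =
  convolve-cong d (λ j b _ → cong (binom (x + j) j ∧_) (Φ-cong n (λ a → P≗P′ ((x + j) ∷ a)) (b ∷ e)))

Φ-+ₚ : ∀ n (P Q : Poly n) → Φ n (P +ₚ Q) ≗ Φ n P +ₚ Φ n Q
Φ-+ₚ zero    P Q (d ∷ e)     = ∧-distribˡ-xor (d ≡ᵇ 0) (P e) (Q e)
Φ-+ₚ (suc n) P Q (d ∷ x ∷ e) =
  trans (convolve-cong d (λ j b _ →
          trans (cong (binom (x + j) j ∧_) (Φ-+ₚ n (slice P (x + j)) (slice Q (x + j)) (b ∷ e)))
                (∧-distribˡ-xor (binom (x + j) j) (Φ n (slice P (x + j)) (b ∷ e)) (Φ n (slice Q (x + j)) (b ∷ e)))))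
        (sumUpTo-xor d (λ j → term P j (d ∸ j)) (λ j → term Q j (d ∸ j)))
  where
  term : Poly (suc n) → ℕ → ℕ → Bool
  term R j b = binom (x + j) j ∧ Φ n (slice R (x + j)) (b ∷ e)

Φ-scale : ∀ n c (P : Poly n) → Φ n (scale c P) ≗ scale c (Φ n P)
Φ-scale zero    c P (d ∷ e)     = ∧-swapˡ (d ≡ᵇ 0) c (P e)
Φ-scale (suc n) c P (d ∷ x ∷ e) =
  trans (convolve-cong d (λ j b _ →
          trans (cong (binom (x + j) j ∧_) (Φ-scale n c (slice P (x + j)) (b ∷ e)))
                (∧-swapˡ (binom (x + j) j) c (Φ n (slice P (x + j)) (b ∷ e)))))
        (sym (∧-distribˡ-sumUpTo d c (λ j → binom (x + j) j ∧ Φ n (slice P (x + j)) ((d ∸ j) ∷ e))))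

Φ-0ₚ : ∀ n → Φ n 0ₚ ≗ 0ₚ
Φ-0ₚ zero    (d ∷ e)     = ∧-zeroʳ (d ≡ᵇ 0)
Φ-0ₚ (suc n) (d ∷ x ∷ e) =
  sumUpTo-zero d (λ j _ → trans (cong (binom (x + j) j ∧_) (Φ-0ₚ n ((d ∸ j) ∷ e))) (∧-zeroʳ _))

Φ-sumUpTo : ∀ n x (F : ℕ → Poly n) →
  Φ n (λ a → sumUpTo x (λ k → F k a)) ≗ (λ e → sumUpTo x (λ k → Φ n (F k) e))
Φ-sumUpTo n zero    F e = refl
Φ-sumUpTo n (suc x) F e =
  trans (Φ-+ₚ n (F 0) (λ a → sumUpTo x (λ k → F (suc k) a)) e)
        (cong (Φ n (F 0) e xor_) (Φ-sumUpTo n x (λ k → F (suc k)) e))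

shear-cong : ∀ {n} {Q Q′ : Poly (suc (suc n))} → Q ≗ Q′ → shear Q ≗ shear Q′
shear-cong Q≗Q′ (d ∷ x ∷ e) = convolve-cong d (λ j b _ → cong (binom (x + j) j ∧_) (Q≗Q′ ((x + j) ∷ b ∷ e)))

shear-*ₚ : ∀ {n} (Q R : Poly (suc (suc n))) → shear (Q *ₚ R) ≗ shear Q *ₚ shear R
shear-*ₚ {n} Q R (d ∷ x ∷ e) = begin
    convolve d (λ J B → binom (x + J) J ∧ (Q *ₚ R) ((x + J) ∷ B ∷ e))
  ≡⟨ convolve-cong d (λ J B _ → cong (binom (x + J) J ∧_)
       (trans (*ₚ-slice Q R (x + J) (B ∷ e))
              (convolve-cong (x + J) (λ a c _ → *ₚ-slice (slice Q a) (slice R c) B e)))) ⟩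
    convolve d (λ J B → binom (x + J) J ∧ convolve (x + J) (λ a c → U a c B))
  ≡⟨ convolve-cong d (λ J B _ → hasse-leibniz x J (λ a c → U a c B)) ⟩
    convolve d (λ J B → convolve x (λ k c → convolve J (λ j₁ j₂ →
      binom (k + j₁) j₁ ∧ (binom (c + j₂) j₂ ∧ U (k + j₁) (c + j₂) B))))
  ≡⟨ convolve-cong d (λ J B _ → convolve-cong x (λ k c _ → convolve-cong J (λ j₁ j₂ _ → pull k c j₁ j₂ B))) ⟩
    convolve d (λ J B → convolve x (λ k c → convolve J (λ j₁ j₂ → convolve B (G k c j₁ j₂))))
  ≡⟨ sumUpTo-comm d x _ ⟩
    convolve x (λ k c → convolve d (λ J B → convolve J (λ j₁ j₂ → convolve B (G k c j₁ j₂))))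
  ≡⟨ convolve-cong x (λ k c _ → sym (convolve-interchange d (λ j₁ b j₂ f → G k c j₁ j₂ b f))) ⟩
    convolve x (λ k c → convolve d (λ l m → convolve l (λ j₁ b → convolve m (λ j₂ f → G k c j₁ j₂ b f))))
  ≡⟨ sumUpTo-comm x d _ ⟩
    convolve d (λ l m → convolve x (λ k c → convolve l (λ j₁ b → convolve m (λ j₂ f → G k c j₁ j₂ b f))))
  ≡⟨ convolve-cong d (λ l m _ → convolve-cong x (λ k c _ → sym (product l m k c))) ⟩
    convolve d (λ l m → convolve x (λ k c → (slice (slice (shear Q) l) k *ₚ slice (slice (shear R) m) c) e))
  ≡⟨ convolve-cong d (λ l m _ → sym (*ₚ-slice (slice (shear Q) l) (slice (shear R) m) x e)) ⟩
    convolve d (λ l m → (slice (shear Q) l *ₚ slice (shear R) m) (x ∷ e))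
  ≡⟨ sym (*ₚ-slice (shear Q) (shear R) d (x ∷ e)) ⟩
    (shear Q *ₚ shear R) (d ∷ x ∷ e) ∎
  where
  open ≡-Reasoning
  T : ℕ → ℕ → ℕ → ℕ → Bool
  T a b c f = (slice (slice Q a) b *ₚ slice (slice R c) f) e
  U : ℕ → ℕ → ℕ → Bool
  U a c B = convolve B (λ b f → T a b c f)
  G : ℕ → ℕ → ℕ → ℕ → ℕ → ℕ → Bool
  G k c j₁ j₂ b f = binom (k + j₁) j₁ ∧ (binom (c + j₂) j₂ ∧ T (k + j₁) b (c + j₂) f)
  pull : ∀ k c j₁ j₂ B →
    binom (k + j₁) j₁ ∧ (binom (c + j₂) j₂ ∧ U (k + j₁) (c + j₂) B) ≡ convolve B (G k c j₁ j₂)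
  pull k c j₁ j₂ B =
    trans (cong (binom (k + j₁) j₁ ∧_) (∧-distribˡ-sumUpTo B (binom (c + j₂) j₂) _))
          (∧-distribˡ-sumUpTo B (binom (k + j₁) j₁) _)
  product : ∀ l m k c →
    (slice (slice (shear Q) l) k *ₚ slice (slice (shear R) m) c) e ≡
    convolve l (λ j₁ b → convolve m (λ j₂ f → G k c j₁ j₂ b f))
  product l m k c =
    trans (*ₚ-sumUpToˡ l (λ j₁ → scale (binom (k + j₁) j₁) (slice (slice Q (k + j₁)) (l ∸ j₁)))
                       (slice (slice (shear R) m) c) e)
    (sumUpTo-cong l (λ j₁ _ →
      trans (*ₚ-scaleˡ (binom (k + j₁) j₁) (slice (slice Q (k + j₁)) (l ∸ j₁)) (slice (slice (shear R) m) c) e)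
      (trans (cong (binom (k + j₁) j₁ ∧_)
        (trans (*ₚ-sumUpToʳ m (slice (slice Q (k + j₁)) (l ∸ j₁))
                            (λ j₂ → scale (binom (c + j₂) j₂) (slice (slice R (c + j₂)) (m ∸ j₂))) e)
               (sumUpTo-cong m (λ j₂ _ → *ₚ-scaleʳ (binom (c + j₂) j₂) (slice (slice Q (k + j₁)) (l ∸ j₁))
                                                   (slice (slice R (c + j₂)) (m ∸ j₂)) e))))
      (∧-distribˡ-sumUpTo m (binom (k + j₁) j₁) _))))

Φ-*ₚ : ∀ n (P Q : Poly n) → Φ n (P *ₚ Q) ≗ Φ n P *ₚ Φ n Q
Φ-*ₚ zero    P Q (d ∷ []) = constant d
  where
  constant : ∀ d → (d ≡ᵇ 0) ∧ (P [] ∧ Q [] xor false) ≡ (Φ zero P *ₚ Φ zero Q) (d ∷ [])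
  constant zero    = sym (*ₚ-slice (Φ zero P) (Φ zero Q) 0 [])
  constant (suc d) = sym (trans (*ₚ-slice (Φ zero P) (Φ zero Q) (suc d) [])
    (sumUpTo-zero (suc d) {λ k → (slice (Φ zero P) k *ₚ slice (Φ zero Q) (suc d ∸ k)) []}
                  (λ { zero _ → cong (_xor false) (∧-zeroʳ (P [])) ; (suc k) _ → refl })))
Φ-*ₚ (suc n) P Q e =
  trans (shear-cong onSlices-*ₚ e) (shear-*ₚ (onSlices (Φ n) P) (onSlices (Φ n) Q) e)
  where
  onSlices-*ₚ : onSlices (Φ n) (P *ₚ Q) ≗ onSlices (Φ n) P *ₚ onSlices (Φ n) Q
  onSlices-*ₚ (x ∷ e) =
    trans (Φ-cong n (*ₚ-slice P Q x) e)
    (trans (Φ-sumUpTo n x (λ k → slice P k *ₚ slice Q (x ∸ k)) e)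
    (trans (sumUpTo-cong x (λ k _ → Φ-*ₚ n (slice P k) (slice Q (x ∸ k)) e))
           (sym (*ₚ-slice (onSlices (Φ n) P) (onSlices (Φ n) Q) x e))))

1ₚ-∷ : ∀ {n} x (e : Mono n) → 1ₚ (x ∷ e) ≡ (x ≡ᵇ 0) ∧ 1ₚ e
1ₚ-∷ x e = trans (isYes≗does _) (cong ((x ≡ᵇ 0) ∧_) (sym (isYes≗does _)))

X-zero-∷ : ∀ {n} x (e : Mono n) → X {suc n} fzero (x ∷ e) ≡ (x ≡ᵇ 1) ∧ 1ₚ e
X-zero-∷ x e = trans (isYes≗does _) (cong ((x ≡ᵇ 1) ∧_) (sym (isYes≗does _)))

X-suc-∷ : ∀ {n} (i : Fin n) x (e : Mono n) → X (fsuc i) (x ∷ e) ≡ (x ≡ᵇ 0) ∧ X i e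
X-suc-∷ i x e = trans (isYes≗does _) (cong ((x ≡ᵇ 0) ∧_) (sym (isYes≗does _)))

Φ-X₀^ : ∀ n c (R : Poly n) (P : Poly (suc n)) → (∀ m a → P (m ∷ a) ≡ (m ≡ᵇ c) ∧ R a) →
  ∀ d x e → Φ (suc n) P (d ∷ x ∷ e) ≡ convolve d (λ j b → binom (x + j) j ∧ (((x + j) ≡ᵇ c) ∧ Φ n R (b ∷ e)))
Φ-X₀^ n c R P P≡X₀^c*R d x e = convolve-cong d (λ j b _ → cong (binom (x + j) j ∧_)
  (trans (Φ-cong n (P≡X₀^c*R (x + j)) (b ∷ e)) (Φ-scale n ((x + j) ≡ᵇ c) R (b ∷ e))))

x+1+j≢ᵇ0 : ∀ x j → ((x + suc j) ≡ᵇ 0) ≡ false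
x+1+j≢ᵇ0 x j = cong (_≡ᵇ 0) (+-suc x j)

x+2+j≢ᵇ1 : ∀ x j → ((x + suc (suc j)) ≡ᵇ 1) ≡ false
x+2+j≢ᵇ1 x j = trans (cong (_≡ᵇ 1) (+-suc x (suc j))) (x+1+j≢ᵇ0 x j)

Φ-X₀^0 : ∀ n (R : Poly n) (P : Poly (suc n)) → (∀ m a → P (m ∷ a) ≡ (m ≡ᵇ 0) ∧ R a) →
  ∀ d x e → Φ (suc n) P (d ∷ x ∷ e) ≡ (x ≡ᵇ 0) ∧ Φ n R (d ∷ e)
Φ-X₀^0 n R P P≡X₀^0*R d x e =
  trans (Φ-X₀^ n 0 R P P≡X₀^0*R d x e)
  (trans (sumUpTo-head d _ (λ j → trans (cong (λ t → binom (x + suc j) (suc j) ∧ (t ∧ Φ n R ((d ∸ suc j) ∷ e)))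
                                                  (x+1+j≢ᵇ0 x j))
                                        (∧-zeroʳ _)))
         (cong (λ t → (t ≡ᵇ 0) ∧ Φ n R (d ∷ e)) (+-identityʳ x)))

Φ-1ₚ : ∀ n → Φ n 1ₚ ≗ 1ₚ
Φ-1ₚ zero    (d ∷ []) = sym (1ₚ-∷ d [])
Φ-1ₚ (suc n) (d ∷ x ∷ e) = begin
    Φ (suc n) 1ₚ (d ∷ x ∷ e)
  ≡⟨ Φ-X₀^0 n 1ₚ 1ₚ 1ₚ-∷ d x e ⟩
    (x ≡ᵇ 0) ∧ Φ n 1ₚ (d ∷ e)
  ≡⟨ cong ((x ≡ᵇ 0) ∧_) (trans (Φ-1ₚ n (d ∷ e)) (1ₚ-∷ d e)) ⟩
    (x ≡ᵇ 0) ∧ ((d ≡ᵇ 0) ∧ 1ₚ e)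
  ≡⟨ ∧-swapˡ (x ≡ᵇ 0) (d ≡ᵇ 0) (1ₚ e) ⟩
    (d ≡ᵇ 0) ∧ ((x ≡ᵇ 0) ∧ 1ₚ e)
  ≡⟨ sym (trans (1ₚ-∷ d (x ∷ e)) (cong ((d ≡ᵇ 0) ∧_) (1ₚ-∷ x e))) ⟩
    1ₚ (d ∷ x ∷ e) ∎
  where open ≡-Reasoning

Φ-X : ∀ n (i : Fin n) → Φ n (X i) ≗ X (fsuc i) +ₚ X fzero
Φ-X (suc n) fzero (d ∷ x ∷ e) = begin
    Φ (suc n) (X fzero) (d ∷ x ∷ e)
  ≡⟨ Φ-X₀^ n 1 1ₚ (X fzero) X-zero-∷ d x e ⟩
    convolve d (λ j b → binom (x + j) j ∧ (((x + j) ≡ᵇ 1) ∧ Φ n 1ₚ (b ∷ e)))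
  ≡⟨ convolve-cong d (λ j b _ → cong (λ t → binom (x + j) j ∧ (((x + j) ≡ᵇ 1) ∧ t))
                                     (trans (Φ-1ₚ n (b ∷ e)) (1ₚ-∷ b e))) ⟩
    convolve d (λ j b → binom (x + j) j ∧ (((x + j) ≡ᵇ 1) ∧ ((b ≡ᵇ 0) ∧ 1ₚ e)))
  ≡⟨ collapse d x ⟩
    ((d ≡ᵇ 0) ∧ ((x ≡ᵇ 1) ∧ 1ₚ e)) xor ((d ≡ᵇ 1) ∧ ((x ≡ᵇ 0) ∧ 1ₚ e))
  ≡⟨ sym (cong₂ _xor_ (trans (X-suc-∷ fzero d (x ∷ e)) (cong ((d ≡ᵇ 0) ∧_) (X-zero-∷ x e)))
                      (trans (X-zero-∷ d (x ∷ e)) (cong ((d ≡ᵇ 1) ∧_) (1ₚ-∷ x e)))) ⟩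
    (X (fsuc fzero) +ₚ X fzero) (d ∷ x ∷ e) ∎
  where
  open ≡-Reasoning
  collapse : ∀ d x →
    convolve d (λ j b → binom (x + j) j ∧ (((x + j) ≡ᵇ 1) ∧ ((b ≡ᵇ 0) ∧ 1ₚ e))) ≡
    ((d ≡ᵇ 0) ∧ ((x ≡ᵇ 1) ∧ 1ₚ e)) xor ((d ≡ᵇ 1) ∧ ((x ≡ᵇ 0) ∧ 1ₚ e))
  collapse zero x rewrite +-identityʳ x = sym (xor-identityʳ _)
  collapse (suc zero) zero = refl
  collapse (suc zero) (suc x) =
    cong₂ _xor_ (∧-zeroʳ ((suc x + 0) ≡ᵇ 1))
                (trans (cong (λ t → binom (suc x + 1) 1 ∧ (t ∧ 1ₚ e)) (x+1+j≢ᵇ0 x 0)) (∧-zeroʳ _))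
  collapse (suc (suc d)) x =
    sumUpTo-zero (suc (suc d)) {λ j → binom (x + j) j ∧ (((x + j) ≡ᵇ 1) ∧ (((suc (suc d) ∸ j) ≡ᵇ 0) ∧ 1ₚ e))} λ
    { zero          _ → ∧-zeroʳ ((x + 0) ≡ᵇ 1)
    ; (suc zero)    _ → trans (cong (binom (x + 1) 1 ∧_) (∧-zeroʳ ((x + 1) ≡ᵇ 1))) (∧-zeroʳ _)
    ; (suc (suc j)) _ → trans (cong (λ t → binom (x + suc (suc j)) (suc (suc j)) ∧ (t ∧ (((d ∸ j) ≡ᵇ 0) ∧ 1ₚ e)))
                                   (x+2+j≢ᵇ1 x j))
                             (∧-zeroʳ _) }
Φ-X (suc n) (fsuc i) (d ∷ x ∷ e) = begin
    Φ (suc n) (X (fsuc i)) (d ∷ x ∷ e)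
  ≡⟨ Φ-X₀^0 n (X i) (X (fsuc i)) (X-suc-∷ i) d x e ⟩
    (x ≡ᵇ 0) ∧ Φ n (X i) (d ∷ e)
  ≡⟨ cong ((x ≡ᵇ 0) ∧_) (trans (Φ-X n i (d ∷ e)) (cong₂ _xor_ (X-suc-∷ i d e) (X-zero-∷ d e))) ⟩
    (x ≡ᵇ 0) ∧ (((d ≡ᵇ 0) ∧ X i e) xor ((d ≡ᵇ 1) ∧ 1ₚ e))
  ≡⟨ trans (∧-distribˡ-xor (x ≡ᵇ 0) _ _)
           (cong₂ _xor_ (∧-swapˡ (x ≡ᵇ 0) (d ≡ᵇ 0) (X i e)) (∧-swapˡ (x ≡ᵇ 0) (d ≡ᵇ 1) (1ₚ e))) ⟩
    ((d ≡ᵇ 0) ∧ ((x ≡ᵇ 0) ∧ X i e)) xor ((d ≡ᵇ 1) ∧ ((x ≡ᵇ 0) ∧ 1ₚ e))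
  ≡⟨ sym (cong₂ _xor_ (trans (X-suc-∷ (fsuc i) d (x ∷ e)) (cong ((d ≡ᵇ 0) ∧_) (X-suc-∷ i x e)))
                      (trans (X-zero-∷ d (x ∷ e)) (cong ((d ≡ᵇ 1) ∧_) (1ₚ-∷ x e)))) ⟩
    (X (fsuc (fsuc i)) +ₚ X fzero) (d ∷ x ∷ e) ∎
  where open ≡-Reasoning

sumFin : ∀ n → (Fin n → Bool) → Bool
sumFin zero    f = false
sumFin (suc n) f = f fzero xor sumFin n (λ k → f (fsuc k))

sumFin-cong : ∀ n {f g : Fin n → Bool} → f ≗ g → sumFin n f ≡ sumFin n g
sumFin-cong zero    f≗g = refl
sumFin-cong (suc n) f≗g = cong₂ _xor_ (f≗g fzero) (sumFin-cong n (λ k → f≗g (fsuc k)))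

sumFin-xor : ∀ n (f g : Fin n → Bool) → sumFin n (λ k → f k xor g k) ≡ sumFin n f xor sumFin n g
sumFin-xor zero    f g = refl
sumFin-xor (suc n) f g =
  trans (cong ((f fzero xor g fzero) xor_) (sumFin-xor n _ _)) (xor-interchange (f fzero) (g fzero) _ _)

∧-distribˡ-sumFin : ∀ n c (f : Fin n → Bool) → c ∧ sumFin n f ≡ sumFin n (λ k → c ∧ f k)
∧-distribˡ-sumFin zero    c f = ∧-zeroʳ c
∧-distribˡ-sumFin (suc n) c f =
  trans (∧-distribˡ-xor c (f fzero) _) (cong ((c ∧ f fzero) xor_) (∧-distribˡ-sumFin n c _))

∧-distribʳ-sumFin : ∀ n c (f : Fin n → Bool) → sumFin n f ∧ c ≡ sumFin n (λ k → f k ∧ c)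
∧-distribʳ-sumFin n c f =
  trans (∧-comm _ c) (trans (∧-distribˡ-sumFin n c f) (sumFin-cong n (λ k → ∧-comm c (f k))))

sumFin-const : ∀ n c → sumFin n (λ _ → c) ≡ binom n 1 ∧ c
sumFin-const zero    c = refl
sumFin-const (suc n) c =
  trans (cong (c xor_) (sumFin-const n c)) (sym (∧-distribʳ-xor c true (binom n 1)))

sumList-tabulate : ∀ n {A : Set} (g : Fin n → A) (f : A → Bool) →
  sumList (tabulate g) f ≡ sumFin n (λ k → f (g k))
sumList-tabulate zero    g f = refl
sumList-tabulate (suc n) g f = cong (f (g fzero) xor_) (sumList-tabulate n (λ k → g (fsuc k)) f)

sumₚ-sumList : ∀ {n} (Ps : List (Poly n)) e → sumₚ Ps e ≡ sumList Ps (λ P → P e)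
sumₚ-sumList []       e = refl
sumₚ-sumList (P ∷ Ps) e = cong (P e xor_) (sumₚ-sumList Ps e)

sumₚ-concatMap : ∀ {n} {A : Set} (h : A → List (Poly n)) (xs : List A) e →
  sumₚ (concatMap h xs) e ≡ sumList xs (λ a → sumₚ (h a) e)
sumₚ-concatMap h xs e =
  trans (sumₚ-sumList (concatMap h xs) e)
  (trans (sumList-concatMap h xs (λ P → P e))
         (sumList-cong xs (λ a → sym (sumₚ-sumList (h a) e))))

linPoly-sumFin : ∀ {n} (a : HomLinForm n) e → linPoly a e ≡ sumFin n (λ k → lookup a k ∧ X k e)
linPoly-sumFin {n} a e =
  trans (sumₚ-sumList (map (λ k → scale (lookup a k) (X k)) (allFin n)) e)
  (trans (sumList-map (λ k → scale (lookup a k) (X k)) (allFin n) (λ P → P e))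
         (sumList-tabulate n (λ k → k) (λ k → lookup a k ∧ X k e)))

Φ-sumFin : ∀ n m (F : Fin m → Poly n) →
  Φ n (λ a → sumFin m (λ k → F k a)) ≗ (λ e → sumFin m (λ k → Φ n (F k) e))
Φ-sumFin n zero    F e = Φ-0ₚ n e
Φ-sumFin n (suc m) F e =
  trans (Φ-+ₚ n (F fzero) (λ a → sumFin m (λ k → F (fsuc k) a)) e)
        (cong (Φ n (F fzero) e xor_) (Φ-sumFin n m (λ k → F (fsuc k)) e))

-- The image of Σₖ aₖ Xₖ under Xₖ ↦ Xₖ₊₁ + X₀ is (Σₖ aₖ) X₀ + Σₖ aₖ Xₖ₊₁.
Φ-form : ∀ {n} → HomLinForm n → HomLinForm (suc n)
Φ-form {n} a = sumFin n (lookup a) ∷ a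

Φ-linPoly : ∀ n (a : HomLinForm n) → Φ n (linPoly a) ≗ linPoly (Φ-form a)
Φ-linPoly n a e = begin
    Φ n (linPoly a) e
  ≡⟨ Φ-cong n (linPoly-sumFin a) e ⟩
    Φ n (λ z → sumFin n (λ k → lookup a k ∧ X k z)) e
  ≡⟨ Φ-sumFin n n (λ k → scale (lookup a k) (X k)) e ⟩
    sumFin n (λ k → Φ n (scale (lookup a k) (X k)) e)
  ≡⟨ sumFin-cong n (λ k → trans (Φ-scale n (lookup a k) (X k) e)
                         (trans (cong (lookup a k ∧_) (Φ-X n k e))
                                (∧-distribˡ-xor (lookup a k) (X (fsuc k) e) (X fzero e)))) ⟩
    sumFin n (λ k → (lookup a k ∧ X (fsuc k) e) xor (lookup a k ∧ X fzero e))
  ≡⟨ trans (sumFin-cong n (λ k → xor-comm (lookup a k ∧ X (fsuc k) e) (lookup a k ∧ X fzero e)))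
           (sumFin-xor n (λ k → lookup a k ∧ X fzero e) (λ k → lookup a k ∧ X (fsuc k) e)) ⟩
    sumFin n (λ k → lookup a k ∧ X fzero e) xor sumFin n (λ k → lookup a k ∧ X (fsuc k) e)
  ≡⟨ cong (_xor sumFin n (λ k → lookup a k ∧ X (fsuc k) e)) (sym (∧-distribʳ-sumFin n (X fzero e) (lookup a))) ⟩
    (sumFin n (lookup a) ∧ X fzero e) xor sumFin n (λ k → lookup a k ∧ X (fsuc k) e)
  ≡⟨ sym (linPoly-sumFin (Φ-form a) e) ⟩
    linPoly (Φ-form a) e ∎
  where open ≡-Reasoning

Φ-circuit : ∀ {n r} → HomΣΠΣ n r → HomΣΠΣ (suc n) r
Φ-circuit = Vec.map (map Φ-form)

Φ-prodₚ : ∀ n (Ls : List (HomLinForm n)) →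
  Φ n (prodₚ (map linPoly Ls)) ≗ prodₚ (map linPoly (map Φ-form Ls))
Φ-prodₚ n []       = Φ-1ₚ n
Φ-prodₚ n (L ∷ Ls) e =
  trans (Φ-*ₚ n (linPoly L) (prodₚ (map linPoly Ls)) e)
        (*ₚ-cong (Φ-linPoly n L) (Φ-prodₚ n Ls) e)

Φ-evalCircuit : ∀ n {r} (C : HomΣΠΣ n r) → Φ n (evalCircuit C) ≗ evalCircuit (Φ-circuit C)
Φ-evalCircuit n []       = Φ-0ₚ n
Φ-evalCircuit n (g ∷ gs) e =
  trans (Φ-+ₚ n (prodₚ (map linPoly g)) (evalCircuit gs) e)
        (cong₂ _xor_ (Φ-prodₚ n g e) (Φ-evalCircuit n gs e))

<ᵇ-suc-suc : ∀ {n} (i j : Fin n) → ⌊ fsuc i <? fsuc j ⌋ ≡ ⌊ i <? j ⌋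
<ᵇ-suc-suc i j = trans (isYes≗does (fsuc i <? fsuc j)) (sym (isYes≗does (i <? j)))

<ᵇ-zero-suc : ∀ {n} (j : Fin n) → ⌊ fzero {n} <? fsuc j ⌋ ≡ true
<ᵇ-zero-suc {n} j = isYes≗does (fzero {n} <? fsuc j)

<ᵇ-zero : ∀ {n} (i : Fin (suc n)) → ⌊ i <? fzero {n} ⌋ ≡ false
<ᵇ-zero {n} i = isYes≗does (i <? fzero {n})

sumPairs : ∀ n → (Fin n → Fin n → Bool) → Bool
sumPairs n F = sumFin n (λ i → sumFin n (λ j → ⌊ i <? j ⌋ ∧ F i j))

sumPairs-cong : ∀ n {F G : Fin n → Fin n → Bool} → (∀ i j → F i j ≡ G i j) → sumPairs n F ≡ sumPairs n G
sumPairs-cong n F≗G = sumFin-cong n (λ i → sumFin-cong n (λ j → cong (⌊ i <? j ⌋ ∧_) (F≗G i j)))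

sumPairs-suc : ∀ n (F : Fin (suc n) → Fin (suc n) → Bool) →
  sumPairs (suc n) F ≡ sumFin n (λ j → F fzero (fsuc j)) xor sumPairs n (λ i j → F (fsuc i) (fsuc j))
sumPairs-suc n F = cong₂ _xor_
  (cong₂ _xor_ (cong (_∧ F fzero fzero) (<ᵇ-zero {n} fzero))
               (sumFin-cong n (λ j → cong (_∧ F fzero (fsuc j)) (<ᵇ-zero-suc j))))
  (sumFin-cong n (λ i → cong₂ _xor_ (cong (_∧ F (fsuc i) fzero) (<ᵇ-zero (fsuc i)))
                                    (sumFin-cong n (λ j → cong (_∧ F (fsuc i) (fsuc j)) (<ᵇ-suc-suc i j)))))

sumPairs-xor : ∀ n (F G : Fin n → Fin n → Bool) →
  sumPairs n (λ i j → F i j xor G i j) ≡ sumPairs n F xor sumPairs n G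
sumPairs-xor n F G =
  trans (sumFin-cong n (λ i → trans (sumFin-cong n (λ j → ∧-distribˡ-xor ⌊ i <? j ⌋ (F i j) (G i j)))
                                    (sumFin-xor n (λ j → ⌊ i <? j ⌋ ∧ F i j) (λ j → ⌊ i <? j ⌋ ∧ G i j))))
        (sumFin-xor n (λ i → sumFin n (λ j → ⌊ i <? j ⌋ ∧ F i j)) (λ i → sumFin n (λ j → ⌊ i <? j ⌋ ∧ G i j)))

-- The coefficient is n - 1, written n + 1 since we work mod 2.
sumPairs-linear : ∀ n (f : Fin n → Bool) → sumPairs n (λ i j → f i xor f j) ≡ binom (suc n) 1 ∧ sumFin n f
sumPairs-linear zero    f = refl
sumPairs-linear (suc n) f = begin
    sumPairs (suc n) (λ i j → f i xor f j)
  ≡⟨ sumPairs-suc n (λ i j → f i xor f j) ⟩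
    sumFin n (λ j → f fzero xor f (fsuc j)) xor sumPairs n (λ i j → f (fsuc i) xor f (fsuc j))
  ≡⟨ cong₂ _xor_ (trans (sumFin-xor n (λ _ → f fzero) (λ j → f (fsuc j)))
                        (cong (_xor sumFin n (λ j → f (fsuc j))) (sumFin-const n (f fzero))))
                 (sumPairs-linear n (λ k → f (fsuc k))) ⟩
    ((binom n 1 ∧ f fzero) xor sumFin n (λ j → f (fsuc j))) xor (binom (suc n) 1 ∧ sumFin n (λ j → f (fsuc j)))
  ≡⟨ combine (binom n 1) (f fzero) _ ⟩
    binom (suc (suc n)) 1 ∧ (f fzero xor sumFin n (λ j → f (fsuc j))) ∎
  where
  open ≡-Reasoning
  combine : ∀ b a s → ((b ∧ a) xor s) xor (not b ∧ s) ≡ not (not b) ∧ (a xor s)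
  combine false a s = xor-same s
  combine true  a s = xor-identityʳ (a xor s)

sumPairs-const : ∀ n c → sumPairs n (λ _ _ → c) ≡ binom n 2 ∧ c
sumPairs-const zero    c = refl
sumPairs-const (suc n) c =
  trans (sumPairs-suc n (λ _ _ → c))
  (trans (cong₂ _xor_ (sumFin-const n c) (sumPairs-const n c))
         (sym (∧-distribʳ-xor c (binom n 1) (binom n 2))))

S2-sumPairs : ∀ n e → S2 n e ≡ sumPairs n (λ i j → (X i *ₚ X j) e)
S2-sumPairs n e =
  trans (sumₚ-concatMap pairsFrom (allFin n) e)
  (trans (sumList-tabulate n (λ k → k) (λ i → sumₚ (pairsFrom i) e))
         (sumFin-cong n (λ i →
           trans (sumₚ-concatMap (λ j → if ⌊ i <? j ⌋ then [ X i *ₚ X j ] else []) (allFin n) e)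
           (trans (sumList-tabulate n (λ k → k) (λ j → sumₚ (if ⌊ i <? j ⌋ then [ X i *ₚ X j ] else []) e))
                  (sumFin-cong n (λ j → sumₚ-if ⌊ i <? j ⌋ (X i *ₚ X j)))))))
  where
  pairsFrom : Fin n → List (Poly n)
  pairsFrom i = concatMap (λ j → if ⌊ i <? j ⌋ then [ X i *ₚ X j ] else []) (allFin n)
  sumₚ-if : ∀ b (P : Poly n) → sumₚ (if b then [ P ] else []) e ≡ b ∧ P e
  sumₚ-if true  P = xor-identityʳ (P e)
  sumₚ-if false P = refl

Φ-sumPairs : ∀ n m (F : Fin m → Fin m → Poly n) →
  Φ n (λ a → sumPairs m (λ i j → F i j a)) ≗ (λ e → sumPairs m (λ i j → Φ n (F i j) e))
Φ-sumPairs n m F e =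
  trans (Φ-sumFin n m (λ i a → sumFin m (λ j → ⌊ i <? j ⌋ ∧ F i j a)) e)
        (sumFin-cong m (λ i → trans (Φ-sumFin n m (λ j → scale ⌊ i <? j ⌋ (F i j)) e)
                                    (sumFin-cong m (λ j → Φ-scale n ⌊ i <? j ⌋ (F i j) e))))

Φ-S2 : ∀ n → binom n 1 ≡ false → binom n 2 ≡ false → Φ n (S2 n) ≗ S2 (suc n)
Φ-S2 n n-even C[n,2]-even e = begin
    Φ n (S2 n) e
  ≡⟨ Φ-cong n (S2-sumPairs n) e ⟩
    Φ n (λ z → sumPairs n (λ i j → (X i *ₚ X j) z)) e
  ≡⟨ Φ-sumPairs n n (λ i j → X i *ₚ X j) e ⟩
    sumPairs n (λ i j → Φ n (X i *ₚ X j) e)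
  ≡⟨ sumPairs-cong n (λ i j → trans (Φ-*ₚ n (X i) (X j) e) (*ₚ-cong (Φ-X n i) (Φ-X n j) e)) ⟩
    sumPairs n (λ i j → ((A i +ₚ Y) *ₚ (A j +ₚ Y)) e)
  ≡⟨ sumPairs-cong n expand ⟩
    sumPairs n (λ i j → (AA i j xor (f i xor f j)) xor c)
  ≡⟨ trans (sumPairs-xor n (λ i j → AA i j xor (f i xor f j)) (λ _ _ → c))
           (cong₂ _xor_ (sumPairs-xor n AA (λ i j → f i xor f j)) (sumPairs-const n c)) ⟩
    (sumPairs n AA xor sumPairs n (λ i j → f i xor f j)) xor (binom n 2 ∧ c)
  ≡⟨ cong₂ (λ u w → (sumPairs n AA xor u) xor w)
           (trans (sumPairs-linear n f) (cong (λ b → not b ∧ sumFin n f) n-even))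
           (cong (_∧ c) C[n,2]-even) ⟩
    (sumPairs n AA xor sumFin n f) xor false
  ≡⟨ trans (xor-identityʳ _) (xor-comm (sumPairs n AA) (sumFin n f)) ⟩
    sumFin n f xor sumPairs n AA
  ≡⟨ sym (trans (S2-sumPairs (suc n) e) (sumPairs-suc n (λ i j → (X i *ₚ X j) e))) ⟩
    S2 (suc n) e ∎
  where
  open ≡-Reasoning
  Y : Poly (suc n)
  Y = X fzero
  A : Fin n → Poly (suc n)
  A i = X (fsuc i)
  AA : Fin n → Fin n → Bool
  AA i j = (A i *ₚ A j) e
  f : Fin n → Bool
  f i = (Y *ₚ A i) e
  c : Bool
  c = (Y *ₚ Y) e
  expand : ∀ i j → ((A i +ₚ Y) *ₚ (A j +ₚ Y)) e ≡ (AA i j xor (f i xor f j)) xor c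
  expand i j = begin
      ((A i +ₚ Y) *ₚ (A j +ₚ Y)) e
    ≡⟨ *ₚ-distribʳ-+ₚ (A i) Y (A j +ₚ Y) e ⟩
      (A i *ₚ (A j +ₚ Y)) e xor (Y *ₚ (A j +ₚ Y)) e
    ≡⟨ cong₂ _xor_ (*ₚ-distribˡ-+ₚ (A i) (A j) Y e) (*ₚ-distribˡ-+ₚ Y (A j) Y e) ⟩
      (AA i j xor (A i *ₚ Y) e) xor (f j xor c)
    ≡⟨ cong (λ t → (AA i j xor t) xor (f j xor c)) (*ₚ-comm (A i) Y e) ⟩
      (AA i j xor f i) xor (f j xor c)
    ≡⟨ trans (sym (xor-assoc (AA i j xor f i) (f j) c)) (cong (_xor c) (xor-assoc (AA i j) (f i) (f j))) ⟩
      (AA i j xor (f i xor f j)) xor c ∎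

binom-4+-1 : ∀ n → binom (4 + n) 1 ≡ binom n 1
binom-4+-1 n = trans (not-involutive _) (not-involutive _)

binom-4+-2 : ∀ n → binom (4 + n) 2 ≡ binom n 2
binom-4+-2 n = period (binom n 1) (binom n 2)
  where
  period : ∀ b c → not (not (not b)) xor (not (not b) xor (not b xor (b xor c))) ≡ c
  period false c = not-involutive c
  period true  c = not-involutive c

4∣⇒binom-1≡false : ∀ n → 4 ∣ n → binom n 1 ≡ false
4∣⇒binom-1≡false n (divides q refl) = go q
  where
  go : ∀ q → binom (q * 4) 1 ≡ false
  go zero    = refl
  go (suc q) = trans (binom-4+-1 (q * 4)) (go q)

4∣⇒binom-2≡false : ∀ n → 4 ∣ n → binom n 2 ≡ false
4∣⇒binom-2≡false n (divides q refl) = go q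
  where
  go : ∀ q → binom (q * 4) 2 ≡ false
  go zero    = refl
  go (suc q) = trans (binom-4+-2 (q * 4)) (go q)

mainTheorem14 : (n : ℕ) → 4 ∣ n → 0 < n →
    ∃ (λ (C : HomΣΠΣ n (n / 2)) → Computes C (S2 n)) →
    ∃ (λ (C : HomΣΠΣ (suc n) (n / 2)) → Computes C (S2 (suc n)))
mainTheorem14 n 4∣n _ (C , C-computes-S2) = Φ-circuit C , λ e → begin
    evalCircuit (Φ-circuit C) e
  ≡⟨ sym (Φ-evalCircuit n C e) ⟩
    Φ n (evalCircuit C) e
  ≡⟨ Φ-cong n C-computes-S2 e ⟩
    Φ n (S2 n) e
  ≡⟨ Φ-S2 n (4∣⇒binom-1≡false n 4∣n) (4∣⇒binom-2≡false n 4∣n) e ⟩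
    S2 (suc n) e ∎
  where open ≡-Reasoning
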